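{- Let $\mathbb{K}$ be a field of characteristic zero and let $(f_n),(g_n),(l_n),(m_n)$ be sequences in $\mathbb{K}$ with $g_0\neq0$, $m_0\neq0$; set $f=\sum f_nx^n$, $g=\sum g_nx^n$, $l=\sum l_nx^n$, $m=\sum m_nx^n$. Let $(p_n(x))_{n\in\mathbb{N}}$ and $(q_n(x))_{n\in\mathbb{N}}$ be the sequences of polynomials defined by $p_0=f_0/g_0$, $q_0=l_0/m_0$ and, for $n\ge1$, \[ p_n(x)=\left(\frac{x-g_1}{g_0}\right)p_{n-1}(x)-\frac{g_2}{g_0}p_{n-2}(x)-\cdots-\frac{g_{n}}{g_0}p_{0}(x)+\frac{f_{n}}{g_0}, \] \[ q_n(x)=\left(\frac{x-m_1}{m_0}\right)q_{n-1}(x)-\frac{m_2}{m_0}q_{n-2}(x)-\cdots-\frac{m_{n}}{m_0}q_{0}(x)+\frac{l_{n}}{m_0}. \] Write $p_n(x)=\sum_{k=0}^n p_{n,k}x^k$ and define the umbral composition $(r_n(x))$ by $r_n(x)=\sum_{k=0}^n p_{n,k}q_k(x)$. Let $(\alpha_n),(\beta_n)$ be defined by $f(x)\,l\!\left(\frac{x}{g(x)}\right)=\sum_{n\ge0}\beta_nx^n$ and $g(x)\,m\!\left(\frac{x}{g(x)}\right)=\sum_{n\ge0}\alpha_nx^n$. Then for all $n\ge1$ \[ r_n(x)=\left(\frac{x-\alpha_1}{\alpha_0}\right)r_{n-1}(x)-\frac{\alpha_2}{\alpha_0}r_{n-2}(x)-\cdots-\frac{\alpha_{n}}{\alpha_0}r_{0}(x)+\frac{\beta_{n}}{\alpha_0}.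 \]
   Context: Note $\alpha_0=g_0m_0\neq0$. The series $l(x/g(x))$, $m(x/g(x))$ denote formal composition in $\mathbb{K}[[x]]$ (well defined since $x/g(x)$ has zero constant term). -}

module Defs where

open import Level using (Level; _⊔_) renaming (suc to lsuc)
open import Data.Nat using (ℕ; zero; suc) renaming (_+_ to _+ℕ_; _∸_ to _∸ℕ_)
open import Data.List using (List; []; _∷_; _++_)
open import Relation.Nullary using (¬_)
open import Algebra.Bundles using (CommutativeRing)

-- A field: a commutative ring with 0 ≠ 1 and a (total) inverse function that
-- is a genuine inverse on every nonzero element (its value at 0 is irrelevant;
-- we fix it to be 0, as in Lean/Mathlib).
record Field (c ℓ : Level) : Set (lsuc (c ⊔ ℓ)) where
  field
    commutativeRing : CommutativeRing c ℓ
  open CommutativeRing commutativeRing public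
  field
    _⁻¹      : Carrier → Carrier
    ⁻¹-cong  : ∀ {x y} → x ≈ y → (x ⁻¹) ≈ (y ⁻¹)
    inverse  : ∀ x → ¬ (x ≈ 0#) → (x * (x ⁻¹)) ≈ 1#
    0⁻¹      : (0# ⁻¹) ≈ 0#
    0≉1      : ¬ (0# ≈ 1#)
  infix 8 _⁻¹

module FieldTheory {c ℓ : Level} (F : Field c ℓ) where
  open Field F

  fromℕ : ℕ → Carrier
  fromℕ zero    = 0#
  fromℕ (suc n) = 1# + fromℕ n

  CharacteristicZero : Set ℓ
  CharacteristicZero = ∀ n → ¬ (fromℕ (suc n) ≈ 0#)

  -- Formal power series K[[x]] as coefficient sequences; polynomials are
  -- power series with finitely many nonzero coefficients.

  Series : Set c
  Series = ℕ → Carrier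

  _≈ₛ_ : Series → Series → Set ℓ
  s ≈ₛ t = ∀ k → s k ≈ t k
  infix 4 _≈ₛ_

  sumTo : ℕ → (ℕ → Carrier) → Carrier
  sumTo zero    h = 0#
  sumTo (suc n) h = sumTo n h + h n

  const : Carrier → Series
  const a zero    = a
  const a (suc k) = 0#

  zeroₛ oneₛ : Series
  zeroₛ = const 0#
  oneₛ  = const 1#

  xₛ : Series
  xₛ zero          = 0#
  xₛ (suc zero)    = 1#
  xₛ (suc (suc k)) = 0#

  _⊕_ _⊖_ _⊛_ : Series → Series → Series
  (s ⊕ t) k = s k + t k
  (s ⊖ t) k = s k - t k
  (s ⊛ t) n = sumTo (suc n) (λ i → s i * t (n ∸ℕ i))
  infixl 6 _⊕_ _⊖_
  infixl 7 _⊛_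

  _·_ : Carrier → Series → Series
  (a · s) k = a * s k
  infixr 8 _·_

  sumₛ : ℕ → (ℕ → Series) → Series
  sumₛ zero    h = zeroₛ
  sumₛ (suc n) h = sumₛ n h ⊕ h n

  powₛ : Series → ℕ → Series
  powₛ h zero    = oneₛ
  powₛ h (suc k) = h ⊛ powₛ h k

  -- Course-of-values recursion: cov d step n = step n (values at < n).
  -- (step n is only ever given the values at indices < n; d is a dummy
  -- default never used by well-behaved steps.)

  module _ {a : Level} {A : Set a} where
    nth : A → List A → ℕ → A
    nth d []       _       = d
    nth d (x ∷ xs) zero    = x
    nth d (x ∷ xs) (suc i) = nth d xs i

    table : A → ((n : ℕ) → (ℕ → A) → A) → ℕ → List A
    table d step zero    = []
    table d step (suc n) =
      table d step n ++ (step n (nth d (table d step n)) ∷ [])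

    cov : A → ((n : ℕ) → (ℕ → A) → A) → ℕ → A
    cov d step n = step n (nth d (table d step n))

  invₛ : Series → Series
  invₛ g = cov 0# step
    where
    step : (n : ℕ) → (ℕ → Carrier) → Carrier
    step zero    b = g 0 ⁻¹
    step (suc n) b =
      - (g 0 ⁻¹ * sumTo (suc n) (λ i → g (suc i) * b (n ∸ℕ i)))

  x/ : Series → Series
  x/ g = xₛ ⊛ invₛ g

  -- formal composition l(h(x)) for h with zero constant term:
  -- coefficient n of l(h) = Σ_{k ≤ n} l_k [x^n] h^k
  _∘ₛ_ : Series → Series → Series
  (l ∘ₛ h) n = sumTo (suc n) (λ k → l k * powₛ h k n)

  -- The right-hand side of the recurrence for index n+1 ≥ 1, given the
  -- coefficient sequences (g_n), (f_n) and earlier terms prev 0 .. prev n: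
  --   ((x - g₁)/g₀) prev_n - (g₂/g₀) prev_{n-1} - ... - (g_{n+1}/g₀) prev_0
  --     + f_{n+1}/g₀
  recStep : (g f : Series) → (prev : ℕ → Series) → ℕ → Series
  recStep g f prev n =
      ((g 0 ⁻¹) · (xₛ ⊖ const (g 1))) ⊛ prev n
    ⊖ sumₛ n (λ i → (g (2 +ℕ i) * g 0 ⁻¹) · prev (n ∸ℕ suc i))
    ⊕ const (f (suc n) * g 0 ⁻¹)

  polySeq : (g f : Series) → ℕ → Series
  polySeq g f = cov zeroₛ step
    where
    step : (n : ℕ) → (ℕ → Series) → Series
    step zero    prev = const (f 0 * g 0 ⁻¹)
    step (suc n) prev = recStep g f prev n

  umbral : (p q : ℕ → Series) → ℕ → Series
  umbral p q n = sumₛ (suc n) (λ k → p n k · q k)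

module Submission where

-- For a sequence of polynomials s₀, s₁, … let C_k(s) = Σ_n s_{n,k} xⁿ
-- be the generating series of its k-th coefficient column.  When g₀ ≠ 0,
-- s satisfies the recurrence with data (g, f) (see recStep) if and only
-- if its columns satisfy the column equations
--     g · C₀(s) = f,        g · C_{k+1}(s) = x · C_k(s),
-- which determine s uniquely; in particular the columns of p = polySeq g f
-- are C_j(p) = (f/g) hʲ with h = x/g.  Hence the columns of the umbral
-- composition r_n = Σ_j p_{n,j} q_j are C_k(r) = (f/g) · (C_k(q) ∘ h).
-- Composition with h is multiplicative and sends x to h, so composing the
-- column equations of q (data (m, l)) with h and multiplying by f yields
-- the column equations of r with data α = g·(m∘h), β = f·(l∘h).  As
-- α₀ = g₀m₀ ≠ 0, r satisfies the recurrence with data (α, β).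

open import Defs
open import Level using (Level)
open import Data.Nat using (ℕ; suc)
open import Relation.Nullary using (¬_)
open import Data.Nat using (zero; z≤n; s≤s)
  renaming (_+_ to _+ℕ_; _∸_ to _∸ℕ_; _≤_ to _≤ℕ_; _<_ to _<ℕ_)
import Data.Nat.Properties as ℕP
import Data.List.Properties as ListP
open import Data.List using ([]; _∷_; _++_; length)
open import Data.Product using (_×_; _,_)
open import Data.Sum using (inj₁; inj₂)
open import Data.Maybe using (nothing)
open import Relation.Binary.PropositionalEquality as P using (_≡_)
open import Relation.Binary.Bundles using (Setoid)
open import Algebra.Bundles using (CommutativeMonoid)
open import Tactic.RingSolver.Core.AlmostCommutativeRing using (fromCommutativeRing)
import Tactic.RingSolver.NonReflective as RingSolver
import Algebra.Solver.CommutativeMonoid as MonoidSolver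

module PowerSeries {c ℓ : Level} (F : Field c ℓ) where
  open Field F
  open FieldTheory F
  open import Relation.Binary.Reasoning.Setoid setoid
  open import Algebra.Properties.Ring ring
    using (-‿distribˡ-*; -‿distribʳ-*; -0#≈0#; -‿+-comm)
  open import Algebra.Properties.CommutativeSemigroup +-commutativeSemigroup
    using () renaming (interchange to +-interchange)
  open import Algebra.Properties.CommutativeSemigroup *-commutativeSemigroup
    using () renaming (interchange to *-interchange)

  divide : ∀ {g₀ a b} → ¬ (g₀ ≈ 0#) → g₀ * a ≈ b → a ≈ g₀ ⁻¹ * b
  divide {g₀} {a} {b} g₀≉0 g₀a≈b = begin
    a                 ≈⟨ *-identityˡ a ⟨
    1# * a            ≈⟨ *-cong (trans (*-comm _ _) (inverse g₀ g₀≉0)) refl ⟨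
    (g₀ ⁻¹ * g₀) * a  ≈⟨ *-assoc _ _ _ ⟩
    g₀ ⁻¹ * (g₀ * a)  ≈⟨ *-cong refl g₀a≈b ⟩
    g₀ ⁻¹ * b         ∎

  *-inverse-cancel : ∀ {g₀} a → ¬ (g₀ ≈ 0#) → g₀ * (g₀ ⁻¹ * a) ≈ a
  *-inverse-cancel {g₀} a g₀≉0 =
    trans (sym (*-assoc _ _ _)) (trans (*-cong (inverse g₀ g₀≉0) refl) (*-identityˡ a))

  *-nonzero : ∀ {a b} → ¬ (a ≈ 0#) → ¬ (b ≈ 0#) → ¬ (a * b ≈ 0#)
  *-nonzero a≉0 b≉0 ab≈0 = b≉0 (trans (divide a≉0 ab≈0) (zeroʳ _))

  move-to-rhs : ∀ {a t e} → a + t ≈ e → a ≈ e - t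
  move-to-rhs {a} {t} {e} a+t≈e = begin
    a            ≈⟨ +-identityʳ a ⟨
    a + 0#       ≈⟨ +-cong refl (-‿inverseʳ t) ⟨
    a + (t - t)  ≈⟨ +-assoc _ _ _ ⟨
    (a + t) - t  ≈⟨ +-cong a+t≈e refl ⟩
    e - t        ∎

  minus-plus-cancel : ∀ e t → (e - t) + t ≈ e
  minus-plus-cancel e t =
    trans (+-assoc _ _ _) (trans (+-cong refl (-‿inverseˡ t)) (+-identityʳ e))

  module ℛ = RingSolver (fromCommutativeRing commutativeRing (λ _ → nothing))

  -- Factoring out a common scalar; this is how recStep is rewritten as
  -- g₀⁻¹ · (target - tail) in recStep-as-quotient.
  factor-scalar : ∀ u X a b C → u * (X - a) - u * b + u * C ≈ u * ((X + C) - (a + b))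
  factor-scalar u X a b C = sym (begin
      u * ((X + C) - (a + b))
    ≈⟨ *-cong refl (ℛ.solve 4 (λ X a b C →
         ((X ℛ.⊕ C) ℛ.⊕ ℛ.⊝ (a ℛ.⊕ b)) ℛ.⊜ (((X ℛ.⊕ ℛ.⊝ a) ℛ.⊕ ℛ.⊝ b) ℛ.⊕ C)) refl X a b C) ⟩
      u * (((X - a) - b) + C)
    ≈⟨ trans (distribˡ _ _ _) (+-cong (distribˡ _ _ _) refl) ⟩
      (u * (X - a) + u * (- b)) + u * C
    ≈⟨ +-cong (+-cong refl (sym (-‿distribʳ-* _ _))) refl ⟩
      u * (X - a) - u * b + u * C
    ∎)

  sum-cong< : ∀ n {u v : ℕ → Carrier} → (∀ i → i <ℕ n → u i ≈ v i) → sumTo n u ≈ sumTo n v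
  sum-cong< zero    u≈v = refl
  sum-cong< (suc n) u≈v =
    +-cong (sum-cong< n (λ i i<n → u≈v i (ℕP.m<n⇒m<1+n i<n))) (u≈v n (ℕP.n<1+n n))

  sum-cong : ∀ n {u v : ℕ → Carrier} → (∀ i → u i ≈ v i) → sumTo n u ≈ sumTo n v
  sum-cong n u≈v = sum-cong< n (λ i _ → u≈v i)

  sum-+ : ∀ n (u v : ℕ → Carrier) → sumTo n (λ i → u i + v i) ≈ sumTo n u + sumTo n v
  sum-+ zero    u v = sym (+-identityˡ 0#)
  sum-+ (suc n) u v = trans (+-cong (sum-+ n u v) refl) (+-interchange _ _ _ _)

  sum-*ˡ : ∀ n a (u : ℕ → Carrier) → a * sumTo n u ≈ sumTo n (λ i → a * u i)
  sum-*ˡ zero    a u = zeroʳ a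
  sum-*ˡ (suc n) a u = trans (distribˡ a _ _) (+-cong (sum-*ˡ n a u) refl)

  sum-*ʳ : ∀ n a (u : ℕ → Carrier) → sumTo n u * a ≈ sumTo n (λ i → u i * a)
  sum-*ʳ zero    a u = zeroˡ a
  sum-*ʳ (suc n) a u = trans (distribʳ a _ _) (+-cong (sum-*ʳ n a u) refl)

  sum-neg : ∀ n (u : ℕ → Carrier) → - sumTo n u ≈ sumTo n (λ i → - u i)
  sum-neg zero    u = -0#≈0#
  sum-neg (suc n) u = trans (sym (-‿+-comm _ _)) (+-cong (sum-neg n u) refl)

  sum-zero : ∀ n (u : ℕ → Carrier) → (∀ i → i <ℕ n → u i ≈ 0#) → sumTo n u ≈ 0#
  sum-zero n u u≈0 = trans (sum-cong< n u≈0) (vanish n)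
    where
    vanish : ∀ n → sumTo n (λ _ → 0#) ≈ 0#
    vanish zero    = refl
    vanish (suc n) = trans (+-identityʳ _) (vanish n)

  sum-head : ∀ n (u : ℕ → Carrier) → sumTo (suc n) u ≈ u 0 + sumTo n (λ i → u (suc i))
  sum-head zero    u = trans (+-identityˡ _) (sym (+-identityʳ _))
  sum-head (suc n) u = trans (+-cong (sum-head n u) refl) (+-assoc _ _ _)

  sum-extend : ∀ m N (u : ℕ → Carrier) → m ≤ℕ N → (∀ i → m ≤ℕ i → u i ≈ 0#) →
               sumTo N u ≈ sumTo m u
  sum-extend m zero    u z≤n u≈0 = refl
  sum-extend m (suc N) u m≤1+N u≈0 with ℕP.m≤n⇒m<n∨m≡n m≤1+N
  ... | inj₂ P.refl        = refl
  ... | inj₁ (s≤s m≤N) =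
    trans (+-cong (sum-extend m N u m≤N u≈0) (u≈0 N m≤N)) (+-identityʳ _)

  sum-swap : ∀ n m (u : ℕ → ℕ → Carrier) →
             sumTo n (λ i → sumTo m (λ j → u i j)) ≈ sumTo m (λ j → sumTo n (λ i → u i j))
  sum-swap zero    m u = sym (sum-zero m _ (λ _ _ → refl))
  sum-swap (suc n) m u = trans (+-cong (sum-swap n m u) refl) (sym (sum-+ m _ _))

  sum-reverse : ∀ n (u : ℕ → Carrier) → sumTo (suc n) u ≈ sumTo (suc n) (λ i → u (n ∸ℕ i))
  sum-reverse zero    u = refl
  sum-reverse (suc n) u = begin
      sumTo (suc (suc n)) u
    ≈⟨ sum-head (suc n) u ⟩
      u 0 + sumTo (suc n) (λ i → u (suc i))
    ≈⟨ +-cong refl (sum-reverse n (λ i → u (suc i))) ⟩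
      u 0 + sumTo (suc n) (λ i → u (suc (n ∸ℕ i)))
    ≈⟨ +-comm _ _ ⟩
      sumTo (suc n) (λ i → u (suc (n ∸ℕ i))) + u 0
    ≈⟨ +-cong (sum-cong< (suc n) (λ i i≤n → reflexive (P.cong u (P.sym (ℕP.+-∸-assoc 1 (ℕP.≤-pred i≤n))))))
              (reflexive (P.cong u (P.sym (ℕP.n∸n≡0 n)))) ⟩
      sumTo (suc n) (λ i → u (suc n ∸ℕ i)) + u (suc n ∸ℕ suc n)
    ∎

  sum-triangle : ∀ n (G : ℕ → ℕ → Carrier) →
    sumTo (suc n) (λ k → sumTo (suc k) (λ a → G a (k ∸ℕ a))) ≈
    sumTo (suc n) (λ a → sumTo (suc (n ∸ℕ a)) (λ b → G a b))
  sum-triangle zero    G = refl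
  sum-triangle (suc n) G = begin
      Diagonals + (NewDiagonal + G (suc n) (n ∸ℕ n))
    ≈⟨ +-cong (sum-triangle n G) (+-cong refl (reflexive (P.cong (G (suc n)) (ℕP.n∸n≡0 n)))) ⟩
      Rows + (NewDiagonal + G (suc n) 0)
    ≈⟨ +-assoc _ _ _ ⟨
      (Rows + NewDiagonal) + G (suc n) 0
    ≈⟨ +-cong (sym (sum-+ (suc n) _ _)) (sym (+-identityˡ _)) ⟩
      sumTo (suc n) (λ a → sumTo (suc (n ∸ℕ a)) (G a) + G a (suc n ∸ℕ a)) + (0# + G (suc n) 0)
    ≈⟨ +-cong (sum-cong< (suc n) (λ a a≤n → longer-row a (ℕP.≤-pred a≤n)))
              (reflexive (P.cong (λ z → sumTo (suc z) (G (suc n))) (P.sym (ℕP.n∸n≡0 n)))) ⟩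
      sumTo (suc n) (λ a → sumTo (suc (suc n ∸ℕ a)) (G a)) + sumTo (suc (suc n ∸ℕ suc n)) (G (suc n))
    ∎
    where
    Diagonals   = sumTo (suc n) (λ k → sumTo (suc k) (λ a → G a (k ∸ℕ a)))
    Rows        = sumTo (suc n) (λ a → sumTo (suc (n ∸ℕ a)) (G a))
    NewDiagonal = sumTo (suc n) (λ a → G a (suc n ∸ℕ a))
    -- each row a ≤ n gains exactly the entry on the new diagonal
    longer-row : ∀ a → a ≤ℕ n → sumTo (suc (n ∸ℕ a)) (G a) + G a (suc n ∸ℕ a) ≈ sumTo (suc (suc n ∸ℕ a)) (G a)
    longer-row a a≤n rewrite ℕP.+-∸-assoc 1 a≤n = refl

  zeroₛ-coefficient : ∀ k → zeroₛ k ≈ 0#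
  zeroₛ-coefficient zero    = refl
  zeroₛ-coefficient (suc k) = refl

  sumₛ-coefficient : ∀ n (h : ℕ → Series) k → sumₛ n h k ≈ sumTo n (λ i → h i k)
  sumₛ-coefficient zero    h k = zeroₛ-coefficient k
  sumₛ-coefficient (suc n) h k = +-cong (sumₛ-coefficient n h k) refl

  sumₛ-cong< : ∀ n {h h′ : ℕ → Series} → (∀ i → i <ℕ n → h i ≈ₛ h′ i) → sumₛ n h ≈ₛ sumₛ n h′
  sumₛ-cong< zero    h≈h′ k = refl
  sumₛ-cong< (suc n) h≈h′ k =
    +-cong (sumₛ-cong< n (λ i i<n → h≈h′ i (ℕP.m<n⇒m<1+n i<n)) k) (h≈h′ n (ℕP.n<1+n n) k)

  seriesSetoid : Setoid c ℓ
  seriesSetoid = record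
    { Carrier       = Series
    ; _≈_           = _≈ₛ_
    ; isEquivalence = record
      { refl  = λ k → refl
      ; sym   = λ s≈t k → sym (s≈t k)
      ; trans = λ s≈t t≈u k → trans (s≈t k) (t≈u k)
      }
    }

  open Setoid seriesSetoid public
    using () renaming (refl to ≈ₛ-refl; sym to ≈ₛ-sym; trans to ≈ₛ-trans)

  ⊛-cong : ∀ {s s′ t t′} → s ≈ₛ s′ → t ≈ₛ t′ → s ⊛ t ≈ₛ s′ ⊛ t′
  ⊛-cong s≈s′ t≈t′ n = sum-cong (suc n) (λ i → *-cong (s≈s′ i) (t≈t′ (n ∸ℕ i)))

  ⊛-comm : ∀ s t → s ⊛ t ≈ₛ t ⊛ s
  ⊛-comm s t n = trans (sum-reverse n _) (sum-cong< (suc n) (λ i i≤n →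
    trans (*-comm _ _) (*-cong (reflexive (P.cong t (ℕP.m∸[m∸n]≡n (ℕP.≤-pred i≤n)))) refl)))

  ⊛-assoc : ∀ s t u → (s ⊛ t) ⊛ u ≈ₛ s ⊛ (t ⊛ u)
  ⊛-assoc s t u n = begin
      sumTo (suc n) (λ k → sumTo (suc k) (λ a → s a * t (k ∸ℕ a)) * u (n ∸ℕ k))
    ≈⟨ sum-cong (suc n) (λ k → trans (sum-*ʳ (suc k) _ _) (sum-cong< (suc k) (λ a a≤k →
         *-cong refl (reflexive (P.cong u (split-index a k (ℕP.≤-pred a≤k))))))) ⟩
      sumTo (suc n) (λ k → sumTo (suc k) (λ a → G a (k ∸ℕ a)))
    ≈⟨ sum-triangle n G ⟩
      sumTo (suc n) (λ a → sumTo (suc (n ∸ℕ a)) (λ b → G a b))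
    ≈⟨ sum-cong (suc n) (λ a → trans (sum-cong (suc (n ∸ℕ a)) (λ b → *-assoc _ _ _))
                                      (sym (sum-*ˡ (suc (n ∸ℕ a)) (s a) _))) ⟩
      sumTo (suc n) (λ a → s a * sumTo (suc (n ∸ℕ a)) (λ b → t b * u (n ∸ℕ a ∸ℕ b)))
    ∎
    where
    G : ℕ → ℕ → Carrier
    G a b = (s a * t b) * u (n ∸ℕ a ∸ℕ b)
    split-index : ∀ a k → a ≤ℕ k → n ∸ℕ k ≡ n ∸ℕ a ∸ℕ (k ∸ℕ a)
    split-index a k a≤k =
      P.trans (P.cong (n ∸ℕ_) (P.sym (ℕP.m+[n∸m]≡n a≤k))) (P.sym (ℕP.∸-+-assoc n a (k ∸ℕ a)))

  const-⊛ : ∀ a s → const a ⊛ s ≈ₛ a · s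
  const-⊛ a s n =
    trans (sum-head n _) (trans (+-cong refl (sum-zero n _ (λ i _ → zeroˡ _))) (+-identityʳ _))

  one-⊛ : ∀ s → oneₛ ⊛ s ≈ₛ s
  one-⊛ s n = trans (const-⊛ 1# s n) (*-identityˡ _)

  ⊛-one : ∀ s → s ⊛ oneₛ ≈ₛ s
  ⊛-one s = ≈ₛ-trans (⊛-comm s oneₛ) (one-⊛ s)

  ⊛-commutativeMonoid : CommutativeMonoid c ℓ
  ⊛-commutativeMonoid = record
    { Carrier = Series ; _≈_ = _≈ₛ_ ; _∙_ = _⊛_ ; ε = oneₛ
    ; isCommutativeMonoid = record
      { isMonoid = record
        { isSemigroup = record
          { isMagma = record { isEquivalence = Setoid.isEquivalence seriesSetoid ; ∙-cong = ⊛-cong }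
          ; assoc   = ⊛-assoc }
        ; identity = one-⊛ , ⊛-one }
      ; comm = ⊛-comm } }

  ·-⊛ : ∀ a s t → (a · s) ⊛ t ≈ₛ a · (s ⊛ t)
  ·-⊛ a s t n = trans (sum-cong (suc n) (λ i → *-assoc _ _ _)) (sym (sum-*ˡ (suc n) a _))

  ⊖-⊛ : ∀ s t u → (s ⊖ t) ⊛ u ≈ₛ s ⊛ u ⊖ t ⊛ u
  ⊖-⊛ s t u n =
    trans (sum-cong (suc n) (λ i → trans (distribʳ _ _ _) (+-cong refl (sym (-‿distribˡ-* _ _)))))
          (trans (sum-+ (suc n) _ _) (+-cong refl (sym (sum-neg (suc n) _))))

  x-⊛-zero : ∀ s → (xₛ ⊛ s) 0 ≈ 0#
  x-⊛-zero s = trans (+-identityˡ _) (zeroˡ _)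

  x-⊛-suc : ∀ s n → (xₛ ⊛ s) (suc n) ≈ s n
  x-⊛-suc s n = begin
      (xₛ ⊛ s) (suc n)
    ≈⟨ sum-head (suc n) _ ⟩
      0# * s (suc n) + sumTo (suc n) (λ i → xₛ (suc i) * s (n ∸ℕ i))
    ≈⟨ +-cong (zeroˡ _) (sum-head n _) ⟩
      0# + (1# * s n + sumTo n (λ i → 0# * s (n ∸ℕ suc i)))
    ≈⟨ +-identityˡ _ ⟩
      1# * s n + sumTo n (λ i → 0# * s (n ∸ℕ suc i))
    ≈⟨ +-cong (*-identityˡ _) (sum-zero n _ (λ i _ → zeroˡ _)) ⟩
      s n + 0#
    ≈⟨ +-identityʳ _ ⟩
      s n
    ∎

  ⊛-constant : ∀ s t → (s ⊛ t) 0 ≈ s 0 * t 0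
  ⊛-constant s t = +-identityˡ _

  module _ {a : Level} {A : Set a} where
    length-table : ∀ (d : A) step n → length (table d step n) ≡ n
    length-table d step zero    = P.refl
    length-table d step (suc n) =
      P.trans (ListP.length-++ (table d step n))
              (P.trans (P.cong (_+ℕ 1) (length-table d step n)) (ℕP.+-comm n 1))

    nth-++ˡ : ∀ (d : A) xs ys i → i <ℕ length xs → nth d (xs ++ ys) i ≡ nth d xs i
    nth-++ˡ d (x ∷ xs) ys zero    _         = P.refl
    nth-++ˡ d (x ∷ xs) ys (suc i) (s≤s i<n) = nth-++ˡ d xs ys i i<n

    nth-++-last : ∀ (d : A) xs y i → i ≡ length xs → nth d (xs ++ y ∷ []) i ≡ y
    nth-++-last d []       y zero    _ = P.refl
    nth-++-last d (x ∷ xs) y (suc i) e = nth-++-last d xs y i (ℕP.suc-injective e)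

    nth-table : ∀ (d : A) step n i → i <ℕ n → nth d (table d step n) i ≡ cov d step i
    nth-table d step (suc n) i i<1+n with ℕP.m≤n⇒m<n∨m≡n (ℕP.≤-pred i<1+n)
    ... | inj₁ i<n    = P.trans (nth-++ˡ d (table d step n) _ i
                                  (P.subst (i <ℕ_) (P.sym (length-table d step n)) i<n))
                                (nth-table d step n i i<n)
    ... | inj₂ P.refl = nth-++-last d (table d step n) _ i (P.sym (length-table d step n))

  invₛ-suc : ∀ g n → invₛ g (suc n) ≈ - (g 0 ⁻¹ * sumTo (suc n) (λ i → g (suc i) * invₛ g (n ∸ℕ i)))
  invₛ-suc g n = -‿cong (*-cong refl (sum-cong< (suc n) (λ i i≤n →
    *-cong refl (reflexive (nth-table 0# _ (suc n) (n ∸ℕ i) (s≤s (ℕP.m∸n≤m n i)))))))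

  ⊛-invₛ : ∀ g → ¬ (g 0 ≈ 0#) → g ⊛ invₛ g ≈ₛ oneₛ
  ⊛-invₛ g g₀≉0 zero    = trans (+-identityˡ _) (inverse (g 0) g₀≉0)
  ⊛-invₛ g g₀≉0 (suc n) = begin
      sumTo (suc (suc n)) (λ i → g i * invₛ g (suc n ∸ℕ i))
    ≈⟨ sum-head (suc n) _ ⟩
      g 0 * invₛ g (suc n) + Rest
    ≈⟨ +-cong (*-cong refl (invₛ-suc g n)) refl ⟩
      g 0 * - (g 0 ⁻¹ * Rest) + Rest
    ≈⟨ +-cong (trans (sym (-‿distribʳ-* _ _)) (-‿cong (*-inverse-cancel Rest g₀≉0))) refl ⟩
      - Rest + Rest
    ≈⟨ -‿inverseˡ Rest ⟩
      0#
    ∎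
    where
    Rest = sumTo (suc n) (λ i → g (suc i) * invₛ g (n ∸ℕ i))

  column : (ℕ → Series) → ℕ → Series
  column s k n = s n k

  ColumnEquations : Series → Series → (ℕ → Series) → Set ℓ
  ColumnEquations g f s =
    (g ⊛ column s 0 ≈ₛ f) × (∀ k → g ⊛ column s (suc k) ≈ₛ xₛ ⊛ column s k)

  recStep-cong : ∀ g f s s′ n → (∀ i → i ≤ℕ n → s i ≈ₛ s′ i) → recStep g f s n ≈ₛ recStep g f s′ n
  recStep-cong g f s s′ n s≈s′ k =
    +-cong (+-cong (⊛-cong ≈ₛ-refl (s≈s′ n ℕP.≤-refl) k)
                   (-‿cong (sumₛ-cong< n (λ i i<n j → *-cong refl (s≈s′ (n ∸ℕ suc i) (ℕP.m∸n≤m n (suc i)) j)) k)))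
           refl

  polySeq-suc : ∀ g f n → polySeq g f (suc n) ≈ₛ recStep g f (polySeq g f) n
  polySeq-suc g f n = recStep-cong g f (nth zeroₛ (table zeroₛ _ (suc n))) (polySeq g f) n
    (λ i i≤n k → reflexive (P.cong (λ s → s k) (nth-table zeroₛ _ (suc n) i (s≤s i≤n))))

  -- The part of [x^{n+1}] g · C_k(s) that does not involve s_{n+1}.
  convTail : Series → (ℕ → Series) → ℕ → ℕ → Carrier
  convTail g s n k = g 1 * s n k + sumTo n (λ i → g (suc (suc i)) * s (n ∸ℕ suc i) k)

  -- The value of [x^{n+1}] g · C_k(s) prescribed by the column equations.
  columnTarget : Series → (ℕ → Series) → ℕ → ℕ → Carrier
  columnTarget f s n k = (xₛ ⊛ s n) k + const (f (suc n)) k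

  conv-split : ∀ g s n k → (g ⊛ column s k) (suc n) ≈ g 0 * s (suc n) k + convTail g s n k
  conv-split g s n k = trans (sum-head (suc n) _) (+-cong refl (sum-head n _))

  recStep-as-quotient : ∀ g f s n k →
    recStep g f s n k ≈ g 0 ⁻¹ * (columnTarget f s n k - convTail g s n k)
  recStep-as-quotient g f s n k = begin
      (((g 0 ⁻¹) · (xₛ ⊖ const (g 1))) ⊛ s n) k
        - sumₛ n (λ i → (g (2 +ℕ i) * g 0 ⁻¹) · s (n ∸ℕ suc i)) k + const (f (suc n) * g 0 ⁻¹) k
    ≈⟨ +-cong (+-cong leading-term (-‿cong lower-terms)) (const-* k) ⟩
      u * ((xₛ ⊛ s n) k - g 1 * s n k) - u * Lower + u * const (f (suc n)) k
    ≈⟨ factor-scalar u _ _ _ _ ⟩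
      u * (columnTarget f s n k - convTail g s n k)
    ∎
    where
    u = g 0 ⁻¹
    Lower = sumTo n (λ i → g (suc (suc i)) * s (n ∸ℕ suc i) k)
    leading-term : (((g 0 ⁻¹) · (xₛ ⊖ const (g 1))) ⊛ s n) k ≈ u * ((xₛ ⊛ s n) k - g 1 * s n k)
    leading-term = trans (·-⊛ u _ (s n) k) (*-cong refl
      (trans (⊖-⊛ xₛ (const (g 1)) (s n) k) (+-cong refl (-‿cong (const-⊛ (g 1) (s n) k)))))
    lower-terms : sumₛ n (λ i → (g (2 +ℕ i) * g 0 ⁻¹) · s (n ∸ℕ suc i)) k ≈ u * Lower
    lower-terms = trans (sumₛ-coefficient n _ k)
      (trans (sum-cong n (λ i → trans (*-cong (*-comm _ _) refl) (*-assoc _ _ _))) (sym (sum-*ˡ n u _)))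
    const-* : ∀ k → const (f (suc n) * u) k ≈ u * const (f (suc n)) k
    const-* zero    = *-comm _ _
    const-* (suc k) = sym (zeroʳ u)

  recurrence⇒column-step : ∀ g f s n → ¬ (g 0 ≈ 0#) → s (suc n) ≈ₛ recStep g f s n →
                           ∀ k → (g ⊛ column s k) (suc n) ≈ columnTarget f s n k
  recurrence⇒column-step g f s n g₀≉0 rec k = begin
      (g ⊛ column s k) (suc n)
    ≈⟨ conv-split g s n k ⟩
      g 0 * s (suc n) k + convTail g s n k
    ≈⟨ +-cong (*-cong refl (trans (rec k) (recStep-as-quotient g f s n k))) refl ⟩
      g 0 * (g 0 ⁻¹ * (columnTarget f s n k - convTail g s n k)) + convTail g s n k
    ≈⟨ +-cong (*-inverse-cancel _ g₀≉0) refl ⟩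
      (columnTarget f s n k - convTail g s n k) + convTail g s n k
    ≈⟨ minus-plus-cancel _ _ ⟩
      columnTarget f s n k
    ∎

  column-step⇒recurrence : ∀ g f s n → ¬ (g 0 ≈ 0#) →
                           (∀ k → (g ⊛ column s k) (suc n) ≈ columnTarget f s n k) →
                           s (suc n) ≈ₛ recStep g f s n
  column-step⇒recurrence g f s n g₀≉0 step k =
    trans (divide g₀≉0 (move-to-rhs (trans (sym (conv-split g s n k)) (step k))))
          (sym (recStep-as-quotient g f s n k))

  columnEquations⇒column-step : ∀ g f s → ColumnEquations g f s →
                                ∀ n k → (g ⊛ column s k) (suc n) ≈ columnTarget f s n k
  columnEquations⇒column-step g f s (eq₀ , eq₊) n zero =
    trans (eq₀ (suc n)) (sym (trans (+-cong (x-⊛-zero (s n)) refl) (+-identityˡ _)))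
  columnEquations⇒column-step g f s (eq₀ , eq₊) n (suc k) =
    trans (eq₊ k (suc n)) (trans (x-⊛-suc (column s k) n) (sym (trans (+-identityʳ _) (x-⊛-suc (s n) k))))

  column-steps⇒columnEquations : ∀ g f s →
    (∀ k → (g ⊛ column s k) 0 ≈ const (f 0) k) →
    (∀ n k → (g ⊛ column s k) (suc n) ≈ columnTarget f s n k) →
    ColumnEquations g f s
  column-steps⇒columnEquations g f s initial step = eq₀ , eq₊
    where
    eq₀ : g ⊛ column s 0 ≈ₛ f
    eq₀ zero    = initial 0
    eq₀ (suc n) = trans (step n 0) (trans (+-cong (x-⊛-zero (s n)) refl) (+-identityˡ _))
    eq₊ : ∀ k → g ⊛ column s (suc k) ≈ₛ xₛ ⊛ column s k
    eq₊ k zero    = trans (initial (suc k)) (sym (x-⊛-zero (column s k)))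
    eq₊ k (suc n) = trans (step n (suc k))
      (trans (+-identityʳ _) (trans (x-⊛-suc (s n) k) (sym (x-⊛-suc (column s k) n))))

  columnEquations⇒recurrence : ∀ g f s → ¬ (g 0 ≈ 0#) → ColumnEquations g f s →
                               ∀ n → s (suc n) ≈ₛ recStep g f s n
  columnEquations⇒recurrence g f s g₀≉0 eqs n =
    column-step⇒recurrence g f s n g₀≉0 (columnEquations⇒column-step g f s eqs n)

  columnEquations⇒initial : ∀ g f s → ¬ (g 0 ≈ 0#) → ColumnEquations g f s →
                            s 0 ≈ₛ const (f 0 * g 0 ⁻¹)
  columnEquations⇒initial g f s g₀≉0 (eq₀ , eq₊) zero =
    trans (divide g₀≉0 (trans (sym (+-identityˡ _)) (eq₀ 0))) (*-comm _ _)
  columnEquations⇒initial g f s g₀≉0 (eq₀ , eq₊) (suc k) =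
    trans (divide g₀≉0 (trans (sym (+-identityˡ _)) (trans (eq₊ k 0) (x-⊛-zero (column s k)))))
          (zeroʳ _)

  polySeq-columnEquations : ∀ g f → ¬ (g 0 ≈ 0#) → ColumnEquations g f (polySeq g f)
  polySeq-columnEquations g f g₀≉0 = column-steps⇒columnEquations g f (polySeq g f) initial
    (λ n → recurrence⇒column-step g f (polySeq g f) n g₀≉0 (polySeq-suc g f n))
    where
    initial : ∀ k → (g ⊛ column (polySeq g f) k) 0 ≈ const (f 0) k
    initial zero    = trans (+-identityˡ _) (trans (*-cong refl (*-comm _ _)) (*-inverse-cancel _ g₀≉0))
    initial (suc k) = trans (+-identityˡ _) (zeroʳ _)

  columnEquations-unique : ∀ g f s s′ → ¬ (g 0 ≈ 0#) →
    ColumnEquations g f s → ColumnEquations g f s′ → ∀ n → s n ≈ₛ s′ n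
  columnEquations-unique g f s s′ g₀≉0 eqs eqs′ n = below n n ℕP.≤-refl
    where
    below : ∀ N i → i ≤ℕ N → s i ≈ₛ s′ i
    below N zero _ = ≈ₛ-trans (columnEquations⇒initial g f s g₀≉0 eqs)
                              (≈ₛ-sym (columnEquations⇒initial g f s′ g₀≉0 eqs′))
    below (suc N) (suc i) (s≤s i≤N) =
      ≈ₛ-trans (columnEquations⇒recurrence g f s g₀≉0 eqs i)
      (≈ₛ-trans (recStep-cong g f s s′ i (λ j j≤i → below N j (ℕP.≤-trans j≤i i≤N)))
                (≈ₛ-sym (columnEquations⇒recurrence g f s′ g₀≉0 eqs′ i)))

  ∘ₛ-constant : ∀ A h → (A ∘ₛ h) 0 ≈ A 0
  ∘ₛ-constant A h = trans (+-identityˡ _) (*-identityʳ _)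

  ∘ₛ-cong : ∀ {A B} h → A ≈ₛ B → (A ∘ₛ h) ≈ₛ (B ∘ₛ h)
  ∘ₛ-cong h A≈B n = sum-cong (suc n) (λ j → *-cong (A≈B j) refl)

  powₛ-+ : ∀ h a b → powₛ h (a +ℕ b) ≈ₛ powₛ h a ⊛ powₛ h b
  powₛ-+ h zero    b = ≈ₛ-sym (one-⊛ (powₛ h b))
  powₛ-+ h (suc a) b =
    ≈ₛ-trans (⊛-cong ≈ₛ-refl (powₛ-+ h a b)) (≈ₛ-sym (⊛-assoc h (powₛ h a) (powₛ h b)))

  module _ (h : Series) (h₀≈0 : h 0 ≈ 0#) where

    powₛ-order : ∀ j n → n <ℕ j → powₛ h j n ≈ 0#
    powₛ-order (suc j) n (s≤s n≤j) = sum-zero (suc n) _ term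
      where
      term : ∀ i → i <ℕ suc n → h i * powₛ h j (n ∸ℕ i) ≈ 0#
      term zero    _         = trans (*-cong h₀≈0 refl) (zeroˡ _)
      term (suc i) (s≤s i<n) = trans (*-cong refl (powₛ-order j (n ∸ℕ suc i)
        (ℕP.<-≤-trans (ℕP.∸-monoʳ-< {n} {suc i} {0} (s≤s z≤n) i<n) n≤j))) (zeroʳ _)

    ∘ₛ-truncate : ∀ A N n → n <ℕ N → (A ∘ₛ h) n ≈ sumTo N (λ j → A j * powₛ h j n)
    ∘ₛ-truncate A N n n<N = sym (sum-extend (suc n) N _ n<N
      (λ j n<j → trans (*-cong refl (powₛ-order j n n<j)) (zeroʳ _)))

    ∘ₛ-⊛-square : ∀ A B n → ((A ⊛ B) ∘ₛ h) n ≈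
      sumTo (suc n) (λ a → sumTo (suc n) (λ b → (A a * B b) * powₛ h (a +ℕ b) n))
    ∘ₛ-⊛-square A B n = begin
        sumTo (suc n) (λ k → sumTo (suc k) (λ a → A a * B (k ∸ℕ a)) * powₛ h k n)
      ≈⟨ sum-cong (suc n) (λ k → trans (sum-*ʳ (suc k) _ _) (sum-cong< (suc k) (λ a a≤k →
           *-cong refl (reflexive (P.cong (λ z → powₛ h z n) (P.sym (ℕP.m+[n∸m]≡n (ℕP.≤-pred a≤k)))))))) ⟩
        sumTo (suc n) (λ k → sumTo (suc k) (λ a → Φ a (k ∸ℕ a)))
      ≈⟨ sum-triangle n Φ ⟩
        sumTo (suc n) (λ a → sumTo (suc (n ∸ℕ a)) (Φ a))
      ≈⟨ sum-cong< (suc n) (λ a a≤n → sym (sum-extend (suc (n ∸ℕ a)) (suc n) _ (s≤s (ℕP.m∸n≤m n a))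
           (λ b n-a<b → trans (*-cong refl (powₛ-order (a +ℕ b) n (beyond a b (ℕP.≤-pred a≤n) n-a<b)))
                              (zeroʳ _)))) ⟩
        sumTo (suc n) (λ a → sumTo (suc n) (Φ a))
      ∎
      where
      Φ : ℕ → ℕ → Carrier
      Φ a b = (A a * B b) * powₛ h (a +ℕ b) n
      beyond : ∀ a b → a ≤ℕ n → suc (n ∸ℕ a) ≤ℕ b → n <ℕ a +ℕ b
      beyond a b a≤n n-a<b = P.subst (_<ℕ a +ℕ b) (ℕP.m+[n∸m]≡n a≤n) (ℕP.+-monoʳ-< a n-a<b)

    square-factors : ∀ A B n →
      sumTo (suc n) (λ a → sumTo (suc n) (λ b → (A a * B b) * (powₛ h a ⊛ powₛ h b) n)) ≈
      ((A ∘ₛ h) ⊛ (B ∘ₛ h)) n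
    square-factors A B n = begin
        sumTo (suc n) (λ a → sumTo (suc n) (λ b → (A a * B b) * (powₛ h a ⊛ powₛ h b) n))
      ≈⟨ sum-cong (suc n) (λ a → sum-cong (suc n) (λ b → trans (sum-*ˡ (suc n) _ _)
           (sum-cong (suc n) (λ i → sym (*-interchange _ _ _ _))))) ⟩
        sumTo (suc n) (λ a → sumTo (suc n) (λ b → sumTo (suc n) (λ i → Ψ a b i)))
      ≈⟨ sum-cong (suc n) (λ a → sum-swap (suc n) (suc n) _) ⟩
        sumTo (suc n) (λ a → sumTo (suc n) (λ i → sumTo (suc n) (λ b → Ψ a b i)))
      ≈⟨ sum-swap (suc n) (suc n) _ ⟩
        sumTo (suc n) (λ i → sumTo (suc n) (λ a → sumTo (suc n) (λ b → Ψ a b i)))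
      ≈⟨ sum-cong (suc n) (λ i → trans (sum-cong (suc n) (λ a → sym (sum-*ˡ (suc n) _ _)))
                                         (sym (sum-*ʳ (suc n) _ _))) ⟩
        sumTo (suc n) (λ i → sumTo (suc n) (λ a → A a * powₛ h a i)
                           * sumTo (suc n) (λ b → B b * powₛ h b (n ∸ℕ i)))
      ≈⟨ sum-cong< (suc n) (λ i i≤n → sym (*-cong (∘ₛ-truncate A (suc n) i i≤n)
                                                  (∘ₛ-truncate B (suc n) (n ∸ℕ i) (s≤s (ℕP.m∸n≤m n i))))) ⟩
        ((A ∘ₛ h) ⊛ (B ∘ₛ h)) n
      ∎
      where
      Ψ : ℕ → ℕ → ℕ → Carrier
      Ψ a b i = (A a * powₛ h a i) * (B b * powₛ h b (n ∸ℕ i))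

    ∘ₛ-⊛ : ∀ A B → ((A ⊛ B) ∘ₛ h) ≈ₛ (A ∘ₛ h) ⊛ (B ∘ₛ h)
    ∘ₛ-⊛ A B n = trans (∘ₛ-⊛-square A B n)
      (trans (sum-cong (suc n) (λ a → sum-cong (suc n) (λ b → *-cong refl (powₛ-+ h a b n))))
             (square-factors A B n))

    x-∘ₛ : (xₛ ∘ₛ h) ≈ₛ h
    x-∘ₛ zero    = trans (+-identityˡ _) (trans (zeroˡ _) (sym h₀≈0))
    x-∘ₛ (suc n) = begin
        (xₛ ∘ₛ h) (suc n)
      ≈⟨ sum-head (suc n) _ ⟩
        0# * powₛ h 0 (suc n) + sumTo (suc n) (λ j → xₛ (suc j) * powₛ h (suc j) (suc n))
      ≈⟨ trans (+-cong (zeroˡ _) (sum-head n _)) (+-identityˡ _) ⟩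
        1# * powₛ h 1 (suc n) + sumTo n (λ j → 0# * powₛ h (suc (suc j)) (suc n))
      ≈⟨ trans (+-cong (*-identityˡ _) (sum-zero n _ (λ _ _ → zeroˡ _))) (+-identityʳ _) ⟩
        (h ⊛ oneₛ) (suc n)
      ≈⟨ ⊛-one h (suc n) ⟩
        h (suc n)
      ∎

  ⊛-∘ₛ-constant-nonzero : ∀ g m h → ¬ (g 0 ≈ 0#) → ¬ (m 0 ≈ 0#) → ¬ ((g ⊛ (m ∘ₛ h)) 0 ≈ 0#)
  ⊛-∘ₛ-constant-nonzero g m h g₀≉0 m₀≉0 α₀≈0 = *-nonzero g₀≉0 m₀≉0 (begin
    g 0 * m 0              ≈⟨ *-cong refl (∘ₛ-constant m h) ⟨
    g 0 * (m ∘ₛ h) 0       ≈⟨ ⊛-constant g (m ∘ₛ h) ⟨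
    (g ⊛ (m ∘ₛ h)) 0       ≈⟨ α₀≈0 ⟩
    0#                     ∎)

  x/-constant : ∀ g → x/ g 0 ≈ 0#
  x/-constant g = x-⊛-zero (invₛ g)

  ⊛-g/g : ∀ g → ¬ (g 0 ≈ 0#) → ∀ s → s ⊛ (g ⊛ invₛ g) ≈ₛ s
  ⊛-g/g g g₀≉0 s = ≈ₛ-trans (⊛-cong ≈ₛ-refl (⊛-invₛ g g₀≉0)) (⊛-one s)

  module ⊛-Solver = MonoidSolver ⊛-commutativeMonoid

  riordanColumn : Series → Series → ℕ → Series
  riordanColumn g f j = (f ⊛ invₛ g) ⊛ powₛ (x/ g) j

  riordan-columnEquations : ∀ g f → ¬ (g 0 ≈ 0#) →
    ColumnEquations g f (λ n j → riordanColumn g f j n)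
  riordan-columnEquations g f g₀≉0 = eq₀ , eq₊
    where
    open ⊛-Solver using (solve; _⊜_; id) renaming (_⊕_ to _⊗_)
    eq₀ : g ⊛ riordanColumn g f 0 ≈ₛ f
    eq₀ = ≈ₛ-trans (solve 3 (λ G Φ I → G ⊗ ((Φ ⊗ I) ⊗ id) ⊜ Φ ⊗ (G ⊗ I)) ≈ₛ-refl g f (invₛ g))
                   (⊛-g/g g g₀≉0 f)
    eq₊ : ∀ k → g ⊛ riordanColumn g f (suc k) ≈ₛ xₛ ⊛ riordanColumn g f k
    eq₊ k = ≈ₛ-trans (solve 5 (λ G Φ I X P → G ⊗ ((Φ ⊗ I) ⊗ ((X ⊗ I) ⊗ P)) ⊜ (X ⊗ ((Φ ⊗ I) ⊗ P)) ⊗ (G ⊗ I))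
                              ≈ₛ-refl g f (invₛ g) xₛ (powₛ (x/ g) k))
                     (⊛-g/g g g₀≉0 _)

  polySeq-columns : ∀ g f → ¬ (g 0 ≈ 0#) → ∀ n j → polySeq g f n j ≈ riordanColumn g f j n
  polySeq-columns g f g₀≉0 n =
    columnEquations-unique g f (polySeq g f) (λ n j → riordanColumn g f j n) g₀≉0
    (polySeq-columnEquations g f g₀≉0) (riordan-columnEquations g f g₀≉0) n

  umbral-columns : ∀ g f (q : ℕ → Series) → ¬ (g 0 ≈ 0#) →
    ∀ k → column (umbral (polySeq g f) q) k ≈ₛ (f ⊛ invₛ g) ⊛ (column q k ∘ₛ x/ g)
  umbral-columns g f q g₀≉0 k n = begin
      umbral (polySeq g f) q n k
    ≈⟨ sumₛ-coefficient (suc n) _ k ⟩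
      sumTo (suc n) (λ j → polySeq g f n j * q j k)
    ≈⟨ sum-cong (suc n) (λ j → trans (*-cong (polySeq-columns g f g₀≉0 n j) refl) (sum-*ʳ (suc n) _ _)) ⟩
      sumTo (suc n) (λ j → sumTo (suc n) (λ a → (f/g a * powₛ h j (n ∸ℕ a)) * q j k))
    ≈⟨ sum-swap (suc n) (suc n) _ ⟩
      sumTo (suc n) (λ a → sumTo (suc n) (λ j → (f/g a * powₛ h j (n ∸ℕ a)) * q j k))
    ≈⟨ sum-cong (suc n) (λ a → trans (sum-cong (suc n) (λ j → trans (*-assoc _ _ _) (*-cong refl (*-comm _ _))))
                                      (sym (sum-*ˡ (suc n) _ _))) ⟩
      sumTo (suc n) (λ a → f/g a * sumTo (suc n) (λ j → q j k * powₛ h j (n ∸ℕ a)))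
    ≈⟨ sum-cong< (suc n) (λ a a≤n → *-cong refl
         (sym (∘ₛ-truncate h (x/-constant g) (column q k) (suc n) (n ∸ℕ a) (s≤s (ℕP.m∸n≤m n a))))) ⟩
      (f/g ⊛ (column q k ∘ₛ h)) n
    ∎
    where
    f/g = f ⊛ invₛ g
    h   = x/ g

module UmbralComposition {c ℓ : Level} (F : Field c ℓ) where
  open Field F using (_≈_; 0#)
  open FieldTheory F
  open PowerSeries F
  open import Relation.Binary.Reasoning.Setoid seriesSetoid
  open ⊛-Solver using (solve; _⊜_) renaming (_⊕_ to _⊗_)

  module _ (g f m l : Series) (q : ℕ → Series) (g₀≉0 : ¬ (g 0 ≈ 0#)) where

    α-⊛-column : ∀ k → (g ⊛ (m ∘ₛ x/ g)) ⊛ ((f ⊛ invₛ g) ⊛ (column q k ∘ₛ x/ g))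
                      ≈ₛ f ⊛ ((m ⊛ column q k) ∘ₛ x/ g)
    α-⊛-column k = begin
        (g ⊛ M) ⊛ ((f ⊛ invₛ g) ⊛ Q)
      ≈⟨ solve 5 (λ G Φ I M Q → (G ⊗ M) ⊗ ((Φ ⊗ I) ⊗ Q) ⊜ (Φ ⊗ (M ⊗ Q)) ⊗ (G ⊗ I))
                 ≈ₛ-refl g f (invₛ g) M Q ⟩
        (f ⊛ (M ⊛ Q)) ⊛ (g ⊛ invₛ g)
      ≈⟨ ⊛-g/g g g₀≉0 _ ⟩
        f ⊛ (M ⊛ Q)
      ≈⟨ ⊛-cong ≈ₛ-refl (∘ₛ-⊛ (x/ g) (x/-constant g) m (column q k)) ⟨
        f ⊛ ((m ⊛ column q k) ∘ₛ x/ g)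
      ∎
      where
      M = m ∘ₛ x/ g
      Q = column q k ∘ₛ x/ g

    umbral-columnEquations : ColumnEquations m l q →
      ColumnEquations (g ⊛ (m ∘ₛ x/ g)) (f ⊛ (l ∘ₛ x/ g)) (umbral (polySeq g f) q)
    umbral-columnEquations (q-eq₀ , q-eq₊) = eq₀ , eq₊
      where
      α = g ⊛ (m ∘ₛ x/ g)
      r = umbral (polySeq g f) q
      h = x/ g
      eq₀ : α ⊛ column r 0 ≈ₛ f ⊛ (l ∘ₛ h)
      eq₀ = begin
          α ⊛ column r 0
        ≈⟨ ⊛-cong ≈ₛ-refl (umbral-columns g f q g₀≉0 0) ⟩
          α ⊛ ((f ⊛ invₛ g) ⊛ (column q 0 ∘ₛ h))
        ≈⟨ α-⊛-column 0 ⟩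
          f ⊛ ((m ⊛ column q 0) ∘ₛ h)
        ≈⟨ ⊛-cong ≈ₛ-refl (∘ₛ-cong h q-eq₀) ⟩
          f ⊛ (l ∘ₛ h)
        ∎
      eq₊ : ∀ k → α ⊛ column r (suc k) ≈ₛ xₛ ⊛ column r k
      eq₊ k = begin
          α ⊛ column r (suc k)
        ≈⟨ ⊛-cong ≈ₛ-refl (umbral-columns g f q g₀≉0 (suc k)) ⟩
          α ⊛ ((f ⊛ invₛ g) ⊛ (column q (suc k) ∘ₛ h))
        ≈⟨ α-⊛-column (suc k) ⟩
          f ⊛ ((m ⊛ column q (suc k)) ∘ₛ h)
        ≈⟨ ⊛-cong ≈ₛ-refl (∘ₛ-cong h (q-eq₊ k)) ⟩
          f ⊛ ((xₛ ⊛ column q k) ∘ₛ h)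
        ≈⟨ ⊛-cong ≈ₛ-refl (≈ₛ-trans (∘ₛ-⊛ h (x/-constant g) xₛ (column q k))
                                     (⊛-cong {t = column q k ∘ₛ h} (x-∘ₛ h (x/-constant g)) ≈ₛ-refl)) ⟩
          f ⊛ ((xₛ ⊛ invₛ g) ⊛ (column q k ∘ₛ h))
        ≈⟨ solve 4 (λ Φ I X Q → Φ ⊗ ((X ⊗ I) ⊗ Q) ⊜ X ⊗ ((Φ ⊗ I) ⊗ Q))
                   ≈ₛ-refl f (invₛ g) xₛ (column q k ∘ₛ h) ⟩
          xₛ ⊛ ((f ⊛ invₛ g) ⊛ (column q k ∘ₛ h))
        ≈⟨ ⊛-cong ≈ₛ-refl (umbral-columns g f q g₀≉0 k) ⟨
          xₛ ⊛ column r k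
        ∎

mainTheorem3 : ∀ {c ℓ : Level} (F : Field c ℓ) →
    let open Field F
        open FieldTheory F
    in CharacteristicZero →
       (f g l m : ℕ → Carrier) →
       ¬ (g 0 ≈ 0#) → ¬ (m 0 ≈ 0#) →
       let p = polySeq g f
           q = polySeq m l
           r = umbral p q
           α = g ⊛ (m ∘ₛ x/ g)
           β = f ⊛ (l ∘ₛ x/ g)
       in ∀ (n : ℕ) → r (suc n) ≈ₛ recStep α β r n
mainTheorem3 F _ f g l m g₀≉0 m₀≉0 =
  columnEquations⇒recurrence α β r α₀≉0
    (umbral-columnEquations g f m l q g₀≉0 (polySeq-columnEquations m l m₀≉0))
  where
  open FieldTheory F
  open PowerSeries F
  open UmbralComposition F
  q = polySeq m l
  r = umbral (polySeq g f) q
  α = g ⊛ (m ∘ₛ x/ g)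
  β = f ⊛ (l ∘ₛ x/ g)
  α₀≉0 = ⊛-∘ₛ-constant-nonzero g m (x/ g) g₀≉0 m₀≉0
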